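{- Let $k\ge0$ and suppose that for all integers $s,q\ge0$ with $s+q=k$, every $(s,q)$-critical ordered graph has at most $m(s,q)$ edges. Then every $k$-critical ordered graph has at most $\sum_{s+q=k}m(s,q)$ edges.
   Context: An ordered graph is a graph with a total order $\prec$ on its vertices. Two edges $uv$, $xy$ ($u\prec v$, $x\prec y$, four distinct endpoints) cross if $u\prec x\prec v\prec y$ or $x\prec u\prec y\prec v$ and nest if $u\prec x\prec y\prec v$ or $x\prec u\prec v\prec y$. A stack (queue) is an edge set with no two crossing (nesting) edges; an $s$-stack $q$-queue layout is a partition of the edges into $s$ stacks and $q$ queues with respect to the given order; a mixed $k$-page layout is an $s$-stack $q$-queue layout with $s+q=k$. $G$ is $(s,q)$-critical if it has no $s$-stack $q$-queue layout but $G-e$ has one for every edge $e$; $G$ is $k$-critical if it has no mixed $k$-page layout but $G-e$ has one for every edge $e$. -}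

module Defs where

open import Data.Nat using (ℕ; suc; _+_; _∸_)
open import Data.Fin using (Fin) renaming (_<_ to _<ᶠ_)
open import Data.Product using (Σ; _×_; _,_)
open import Data.Sum using (_⊎_; inj₁; inj₂)
open import Data.List using (List; length; map; upTo)
open import Data.Nat.ListAction using (sum)
open import Data.List.Relation.Unary.All using (All)
open import Data.List.Relation.Unary.Unique.Propositional using (Unique)
open import Data.List.Membership.Propositional using (_∈_)
open import Relation.Binary.PropositionalEquality using (_≡_; _≢_)
open import Relation.Nullary using (¬_)

Edge : ℕ → Set
Edge n = Fin n × Fin n

record OrderedGraph : Set where
  field
    n      : ℕ
    edges  : List (Edge n)
    sorted : All (λ { (u , v) → u <ᶠ v }) edges
    simple : Unique edges
open OrderedGraph public

∥_∥ : OrderedGraph → ℕ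
∥ G ∥ = length (edges G)

-- crossing and nesting of two edges (strict inequalities force four distinct endpoints)
Cross : ∀ {n} → Edge n → Edge n → Set
Cross (u , v) (x , y) =
  (u <ᶠ x × x <ᶠ v × v <ᶠ y) ⊎ (x <ᶠ u × u <ᶠ y × y <ᶠ v)

Nest : ∀ {n} → Edge n → Edge n → Set
Nest (u , v) (x , y) =
  (u <ᶠ x × x <ᶠ y × y <ᶠ v) ⊎ (x <ᶠ u × u <ᶠ v × v <ᶠ y)

-- An s-stack q-queue layout of the edge set described by P (a predicate on edges):
-- each edge gets a page, inj₁ i = i-th stack, inj₂ j = j-th queue; no two edges on
-- a common stack cross, no two edges on a common queue nest.
Layout : ∀ {n} → ℕ → ℕ → (Edge n → Set) → Set
Layout {n} s q P =
  Σ (Edge n → Fin s ⊎ Fin q) λ page →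
    (∀ e f → P e → P f →
       (∀ i → page e ≡ inj₁ i → page f ≡ inj₁ i → ¬ Cross e f) ×
       (∀ j → page e ≡ inj₂ j → page f ≡ inj₂ j → ¬ Nest e f))

EdgeOf : (G : OrderedGraph) → Edge (n G) → Set
EdgeOf G f = f ∈ edges G

EdgeOfMinus : (G : OrderedGraph) → Edge (n G) → Edge (n G) → Set
EdgeOfMinus G e f = f ∈ edges G × f ≢ e

HasSQLayout : ℕ → ℕ → OrderedGraph → Set
HasSQLayout s q G = Layout s q (EdgeOf G)

HasMixedLayout : ℕ → OrderedGraph → Set
HasMixedLayout k G = Σ ℕ λ s → Σ ℕ λ q → s + q ≡ k × HasSQLayout s q G

HasMixedLayoutMinus : ℕ → (G : OrderedGraph) → Edge (n G) → Set
HasMixedLayoutMinus k G e =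
  Σ ℕ λ s → Σ ℕ λ q → s + q ≡ k × Layout s q (EdgeOfMinus G e)

SQCritical : ℕ → ℕ → OrderedGraph → Set
SQCritical s q G =
  ¬ HasSQLayout s q G × (∀ e → e ∈ edges G → Layout s q (EdgeOfMinus G e))

KCritical : ℕ → OrderedGraph → Set
KCritical k G =
  ¬ HasMixedLayout k G × (∀ e → e ∈ edges G → HasMixedLayoutMinus k G e)

-- Σ_{s+q=k} m(s,q) = Σ_{s=0}^{k} m(s, k - s)
sumOver : ℕ → (ℕ → ℕ → ℕ) → ℕ
sumOver k m = sum (map (λ s → m s (k ∸ s)) (upTo (suc k)))

-- For each s ≤ k, G has no s-stack (k ∸ s)-queue layout, so
-- deleting edges as long as that property survives ends in an (s , k ∸ s)-critical
-- spanning subgraph C s, with at most m s (k ∸ s) edges. Every edge e of G lies in one of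
-- them: G − e has an s-stack (k ∸ s)-queue layout for some s, and if e were missing from
-- C s that layout would restrict to C s. Hence ∥ G ∥ ≤ Σₛ ∥ C s ∥ ≤ Σₛ m s (k ∸ s).
-- Layouts are not decidable here, so the argument runs in the double-negation monad; the
-- conclusion is a decidable inequality and thus stable.
module Submission where

open import Defs
open import Level using (0ℓ)
open import Data.Nat using (ℕ; suc; _+_; _∸_; _≤_; _<_; z≤n; s≤s; _≤?_)
open import Data.Nat.Properties
  using (≤-trans; ≤-pred; +-mono-≤; m≤m+n; m+n∸m≡n; m+[n∸m]≡n; module ≤-Reasoning)
open import Data.Nat.Induction using (<-wellFounded)
open import Data.Fin.Properties using () renaming (_≟_ to _≟ᶠ_)
open import Data.Product using (Σ-syntax; ∃; ∃₂; _×_; _,_; proj₁; proj₂; uncurry)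
open import Data.Product.Properties using (≡-dec)
open import Data.List using (List; []; _∷_; _++_; length; concat; map; filter; upTo)
open import Data.List.Properties using (filter-notAll; length-++)
open import Data.Nat.ListAction using (sum)
open import Data.List.Relation.Unary.Any using (Any; here; there)
import Data.List.Relation.Unary.Any as Any
open import Data.List.Relation.Unary.Any.Properties using (mapWith∈⁺)
import Data.List.Relation.Unary.All as All
open import Data.List.Relation.Unary.Unique.Propositional using (Unique; _∷_)
import Data.List.Relation.Unary.Unique.Propositional.Properties as Unique
open import Data.List.Membership.Propositional using (_∈_; mapWith∈)
open import Data.List.Membership.Propositional.Properties
  using (∈-filter⁺; ∈-filter⁻; ∈-concat⁺; ∈-upTo⁺; ∈-upTo⁻)
open import Data.List.Relation.Binary.Subset.Propositional using (_⊆_)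
open import Effect.Monad using (RawMonad)
open import Function using (_∘′_)
open import Induction.WellFounded using (Acc; acc)
open import Relation.Binary.Definitions using (DecidableEquality)
open import Relation.Binary.PropositionalEquality using (_≡_; _≢_; refl; sym; subst)
open import Relation.Nullary using (¬_; Dec; yes; no; ¬?)
open import Relation.Nullary.Decidable using (¬¬-excluded-middle; decidable-stable)
open import Relation.Nullary.Negation using (¬¬-Monad)

open RawMonad (¬¬-Monad {0ℓ})

¬¬-∀∈ : ∀ {A : Set} {P : A → Set} (xs : List A) →
        (∀ {x} → x ∈ xs → ¬ ¬ P x) → ¬ ¬ (∀ {x} → x ∈ xs → P x)
¬¬-∀∈ xs h = All.lookup <$> All.sequenceM 0ℓ ¬¬-Monad (All.tabulate h)

module _ {A : Set} (_≟_ : DecidableEquality A) where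

  unique-length-≤ : ∀ {xs ys : List A} → Unique xs → xs ⊆ ys → length xs ≤ length ys
  unique-length-≤ {[]}     _            _     = z≤n
  unique-length-≤ {x ∷ xs} {ys} (x∉xs ∷ u) xs⊆ys =
    ≤-trans (s≤s (unique-length-≤ u xs⊆ys-x)) (filter-notAll ≢x? ys x∈ys)
    where
    ≢x? : (y : A) → Dec (y ≢ x)
    ≢x? y = ¬? (y ≟ x)
    xs⊆ys-x : xs ⊆ filter ≢x? ys
    xs⊆ys-x y∈xs = ∈-filter⁺ ≢x? (xs⊆ys (there y∈xs)) (λ y≡x → All.lookup x∉xs y∈xs (sym y≡x))
    x∈ys : Any (λ y → ¬ y ≢ x) ys
    x∈ys = Any.map (λ x≡y y≢x → y≢x (sym x≡y)) (xs⊆ys (here refl))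

length-concat-mapWith∈-≤ : ∀ {A B : Set} (xs : List A) (g : ∀ {x} → x ∈ xs → List B)
  {f : A → ℕ} → (∀ {x} (x∈xs : x ∈ xs) → length (g x∈xs) ≤ f x) →
  length (concat (mapWith∈ xs g)) ≤ sum (map f xs)
length-concat-mapWith∈-≤ []       g bound = z≤n
length-concat-mapWith∈-≤ (x ∷ xs) g bound = begin
  length (g (here refl) ++ concat (mapWith∈ xs (g ∘′ there)))
    ≡⟨ length-++ (g (here refl)) ⟩
  length (g (here refl)) + length (concat (mapWith∈ xs (g ∘′ there)))
    ≤⟨ +-mono-≤ (bound (here refl))
                (length-concat-mapWith∈-≤ xs (g ∘′ there) (λ x∈xs → bound (there x∈xs))) ⟩
  _ ∎
  where open ≤-Reasoning

restrictLayout : ∀ {n s q} {P Q : Edge n → Set} → (∀ {e} → Q e → P e) → Layout s q P → Layout s q Q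
restrictLayout Q⇒P (page , valid) = page , λ e f Qe Qf → valid e f (Q⇒P Qe) (Q⇒P Qf)

_≟ₑ_ : ∀ {n} → DecidableEquality (Edge n)
_≟ₑ_ = ≡-dec _≟ᶠ_ _≟ᶠ_

record SpanningSubgraph (G : OrderedGraph) : Set where
  field
    edgeList : List (Edge (n G))
    unique   : Unique edgeList
    ⊆-edges  : edgeList ⊆ edges G
open SpanningSubgraph

whole : (G : OrderedGraph) → SpanningSubgraph G
whole G = record { edgeList = edges G ; unique = simple G ; ⊆-edges = λ e∈G → e∈G }

module _ {G : OrderedGraph} where

  open import Data.List.Membership.DecPropositional (_≟ₑ_ {n G}) using (_∈?_)

  graph : SpanningSubgraph G → OrderedGraph
  graph H = record
    { n      = n G
    ; edges  = edgeList H
    ; sorted = All.tabulate (λ e∈H → All.lookup (sorted G) (⊆-edges H e∈H))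
    ; simple = unique H
    }

  ≢? : (e f : Edge (n G)) → Dec (f ≢ e)
  ≢? e f = ¬? (f ≟ₑ e)

  _─_ : SpanningSubgraph G → Edge (n G) → SpanningSubgraph G
  H ─ e = record
    { edgeList = filter (≢? e) (edgeList H)
    ; unique   = Unique.filter⁺ (≢? e) (unique H)
    ; ⊆-edges  = λ f∈ → ⊆-edges H (proj₁ (∈-filter⁻ (≢? e) f∈))
    }

  ∥─∥< : ∀ {H e} → e ∈ edgeList H → ∥ graph (H ─ e) ∥ < ∥ graph H ∥
  ∥─∥< {H} {e} e∈H = filter-notAll (≢? e) (edgeList H) (Any.map (λ e≡f f≢e → f≢e (sym e≡f)) e∈H)

  layout-─⇒layout-minus : ∀ {s q H e} →
    HasSQLayout s q (graph (H ─ e)) → Layout s q (EdgeOfMinus (graph H) e)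
  layout-─⇒layout-minus {e = e} = restrictLayout (uncurry (∈-filter⁺ (≢? e)))

  ∈-of-unlayoutable : ∀ {s q e} (C : SpanningSubgraph G) → ¬ HasSQLayout s q (graph C) →
    Layout s q (EdgeOfMinus G e) → e ∈ edgeList C
  ∈-of-unlayoutable {e = e} C ¬layout layout =
    decidable-stable (e ∈? edgeList C) λ e∉C →
      ¬layout (restrictLayout (λ f∈C → ⊆-edges C f∈C , λ f≡e → e∉C (subst (_∈ edgeList C) f≡e f∈C))
                              layout)

  ∥∥-≤-sum-of-cover : ∀ {A : Set} (xs : List A) (C : ∀ {x} → x ∈ xs → SpanningSubgraph G)
    {f : A → ℕ} → (∀ {x} (x∈xs : x ∈ xs) → ∥ graph (C x∈xs) ∥ ≤ f x) →
    (∀ {e} → e ∈ edges G → ∃₂ λ x (x∈xs : x ∈ xs) → e ∈ edgeList (C x∈xs)) →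
    ∥ G ∥ ≤ sum (map f xs)
  ∥∥-≤-sum-of-cover xs C bound cover = ≤-trans
    (unique-length-≤ _≟ₑ_ (simple G) (∈-concat⁺ ∘′ mapWith∈⁺ (edgeList ∘′ C) ∘′ cover))
    (length-concat-mapWith∈-≤ xs (edgeList ∘′ C) bound)

CriticalSubgraph : ℕ → ℕ → OrderedGraph → Set
CriticalSubgraph s q G = Σ[ C ∈ SpanningSubgraph G ] SQCritical s q (graph C)

critical-subgraph : ∀ {s q G} (H : SpanningSubgraph G) → ¬ HasSQLayout s q (graph H) →
  ¬ ¬ CriticalSubgraph s q G
critical-subgraph H = go H (<-wellFounded ∥ graph H ∥)
  where
  go : ∀ {s q G} (H : SpanningSubgraph G) → Acc _<_ ∥ graph H ∥ → ¬ HasSQLayout s q (graph H) →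
    ¬ ¬ CriticalSubgraph s q G
  go {s} {q} H (acc smaller) ¬layout =
    ¬¬-excluded-middle {A = ∃ λ e → e ∈ edgeList H × ¬ Layout s q (EdgeOfMinus (graph H) e)} >>= λ where
      (yes (e , e∈H , ¬layout-minus)) →
        go (H ─ e) (smaller (∥─∥< {H = H} e∈H)) (¬layout-minus ∘′ layout-─⇒layout-minus {H = H})
      (no none-undeletable) → do
        deletable ← ¬¬-∀∈ (edgeList H) λ e∈H ¬layout-minus → none-undeletable (_ , e∈H , ¬layout-minus)
        pure (H , ¬layout , λ _ → deletable)

m+n≡o⇒m∈upTo[1+o]×n≡o∸m : ∀ {m n o} → m + n ≡ o → m ∈ upTo (suc o) × n ≡ o ∸ m
m+n≡o⇒m∈upTo[1+o]×n≡o∸m {m} {n} refl = ∈-upTo⁺ (s≤s (m≤m+n m n)) , sym (m+n∸m≡n m n)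

lemma22 : (k : ℕ) (m : ℕ → ℕ → ℕ) →
    (∀ s q → s + q ≡ k → ∀ G → SQCritical s q G → ∥ G ∥ ≤ m s q) →
    ∀ G → KCritical k G → ∥ G ∥ ≤ sumOver k m
lemma22 k m bound G (¬mixed , deletable) = decidable-stable (_ ≤? _) do
    critical ← ¬¬-∀∈ (upTo (suc k)) λ s∈ → critical-subgraph (whole G) λ layout →
      ¬mixed (_ , _ , s+[k∸s]≡k s∈ , layout)
    pure (∥∥-≤-sum-of-cover (upTo (suc k)) (proj₁ ∘′ critical)
      (λ s∈ → bound _ _ (s+[k∸s]≡k s∈) (graph (proj₁ (critical s∈))) (proj₂ (critical s∈)))
      (covered critical))
  where
  s+[k∸s]≡k : ∀ {s} → s ∈ upTo (suc k) → s + (k ∸ s) ≡ k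
  s+[k∸s]≡k s∈ = m+[n∸m]≡n (≤-pred (∈-upTo⁻ s∈))

  covered : (critical : ∀ {s} → s ∈ upTo (suc k) → CriticalSubgraph s (k ∸ s) G) →
    ∀ {e} → e ∈ edges G → ∃₂ λ s (s∈ : s ∈ upTo (suc k)) → e ∈ edgeList (proj₁ (critical s∈))
  covered critical {e} e∈G with deletable e e∈G
  ... | s , q , s+q≡k , layout with m+n≡o⇒m∈upTo[1+o]×n≡o∸m {s} {q} s+q≡k
  ...   | s∈ , refl =
    s , s∈ , ∈-of-unlayoutable (proj₁ (critical s∈)) (proj₁ (proj₂ (critical s∈))) layout
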